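{- Let $f$ be a bn-independent broadcast on a connected graph $G$ such that $|V_{f}^{+}|\geq2$. Then $f$ is maximal bn-independent if and only if each component of $G-U_{f}^{E}$ contains at least two broadcasting vertices (vertices of $V_f^+$).
   Context: A broadcast on a connected graph $G=(V,E)$ is a function $f:V\to\{0,1,\dots,\operatorname{diam}(G)\}$ with $f(v)\le e(v)$ (the eccentricity of $v$) for all $v$ if $|V|\ge 2$, and $f(v)=1$ if $V=\{v\}$; $V_f^+=\{v:f(v)>0\}$ is the set of broadcasting vertices. For $v\in V_f^+$, $N_f(v)=\{u:d(u,v)\le f(v)\}$ and $B_f(v)=\{u:d(u,v)=f(v)\}$. A broadcast $f$ is bn-independent if every vertex $x$ that lies in $N_f(v)$ for more than one $v\in V_f^+$ satisfies $d(x,u)\ge f(u)$ for all $u\in V_f^+$; it is maximal bn-independent if it is bn-independent and there is no bn-independent broadcast $g\ne f$ on $G$ with $g(v)\ge f(v)$ for all $v$. An edge $xy$ is covered by $u\in V_f^+$ if $x,y\in N_f(u)$ and at least one of $x,y$ is not in $B_f(u)$; $U_f^E$ denotes the set of edges not covered by any vertex of $V_f^+$, and $G-U_f^E$ is the spanning subgraph obtained by deleting these edges. -}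

module Defs where

open import Data.Nat using (ℕ; zero; suc; _≤_; _<_; _⊔_)
open import Data.Fin using (Fin)
open import Data.Fin.Properties using (_≟_)
open import Data.Bool using (Bool; true; false; _∧_; _∨_; if_then_else_)
open import Data.List using (List; foldr; map; allFin)
open import Data.Bool.ListAction using (any)
open import Data.Product using (Σ; ∃; ∃-syntax; _×_; _,_)
open import Data.Sum using (_⊎_)
open import Relation.Nullary using (¬_)
open import Relation.Nullary.Decidable using (⌊_⌋)
open import Relation.Binary.PropositionalEquality using (_≡_; _≢_)
open import Relation.Binary.Construct.Closure.ReflexiveTransitive using (Star)

record Graph (n : ℕ) : Set where
  field
    adj    : Fin n → Fin n → Bool
    sym    : ∀ u v → adj u v ≡ adj v u
    irrefl : ∀ v → adj v v ≡ false
open Graph public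

module _ {n : ℕ} (G : Graph n) where

  within : ℕ → Fin n → Fin n → Bool
  within zero    u v = ⌊ u ≟ v ⌋
  within (suc k) u v = within k u v ∨ any (λ w → adj G u w ∧ within k w v) (allFin n)

  -- G is connected: any two vertices are joined by a walk (G nonempty is
  -- not required here; the theorem's hypotheses force n ≥ 2).
  Connected : Set
  Connected = ∀ u v → ∃[ k ] within k u v ≡ true

least : (ℕ → Bool) → ℕ → ℕ → ℕ
least p i zero       = i
least p i (suc fuel) = if p i then i else least p (suc i) fuel

module _ {n : ℕ} (G : Graph n) where

  -- Distance d(u,v): least k with a walk of length ≤ k (k ≤ n; in a
  -- connected graph this is the usual shortest-path distance).
  dist : Fin n → Fin n → ℕ
  dist u v = least (λ k → within G k u v) 0 n

  ecc : Fin n → ℕ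
  ecc v = foldr _⊔_ 0 (map (dist v) (allFin n))

  IsBroadcast : (Fin n → ℕ) → Set
  IsBroadcast f = (2 ≤ n → ∀ v → f v ≤ ecc v) × (n ≡ 1 → ∀ v → f v ≡ 1)

  Broadcasting : (Fin n → ℕ) → Fin n → Set
  Broadcasting f v = 0 < f v

  InN : (Fin n → ℕ) → Fin n → Fin n → Set
  InN f v u = dist u v ≤ f v

  InB : (Fin n → ℕ) → Fin n → Fin n → Set
  InB f v u = dist u v ≡ f v

  BnIndependent : (Fin n → ℕ) → Set
  BnIndependent f =
    ∀ x → (∃[ v ] ∃[ w ] (v ≢ w × Broadcasting f v × Broadcasting f w × InN f v x × InN f w x))
        → ∀ u → Broadcasting f u → f u ≤ dist x u

  MaximalBnIndependent : (Fin n → ℕ) → Set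
  MaximalBnIndependent f =
    BnIndependent f ×
    (∀ g → IsBroadcast g → BnIndependent g → (∀ v → f v ≤ g v) → ∀ v → g v ≡ f v)

  CoveredBy : (Fin n → ℕ) → Fin n → Fin n → Fin n → Set
  CoveredBy f u x y =
    Broadcasting f u × InN f u x × InN f u y × (¬ InB f u x ⊎ ¬ InB f u y)

  -- adjacency in the spanning subgraph G - U_f^E (edges covered by some u)
  CovAdj : (Fin n → ℕ) → Fin n → Fin n → Set
  CovAdj f x y = adj G x y ≡ true × ∃[ u ] CoveredBy f u x y

  SameComponent : (Fin n → ℕ) → Fin n → Fin n → Set
  SameComponent f x y = Star (CovAdj f) x y

  EveryComponentTwoBroadcasters : (Fin n → ℕ) → Set
  EveryComponentTwoBroadcasters f =
    ∀ x → ∃[ u ] ∃[ v ] (u ≢ v × Broadcasting f u × Broadcasting f v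
                          × SameComponent f x u × SameComponent f x v)

module Submission where

-- Call s shared under f if some vertex of N_f(s) also lies in N_f(u) for a broadcasting
-- u ≠ s.  Both sides of the equivalence say that every vertex is shared.
-- If s is not shared, raising f(s) by one keeps f a bn-independent broadcast: the only
-- new overlaps lie at distance f(s)+1 from s, and a broadcasting u reaching such a vertex
-- strictly inside N_f(u) would also reach its neighbour in N_f(s).  Conversely, a common
-- vertex y of N_f(s) and N_f(u) caps every bn-independent g ≥ f at s by
-- g(s) ≤ d(y,s) ≤ f(s).  On the graph side, a walk of covered edges from s to another
-- broadcaster leaves N_f(s) through an edge covered by some u ≠ s, which makes s shared;
-- and if every vertex is shared, each x is joined along a geodesic of covered edges to a
-- broadcaster u, whose shared vertex joins it to a second broadcaster.

open import Defs
open import Data.Nat using (ℕ; zero; suc; _+_; _≤_; _<_; _≤′_; ≤′-refl; ≤′-step; _⊔_; z≤n; s≤s; _≤?_; _<?_)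
open import Data.Nat.Properties
  using (≤-reflexive; ≤-trans; ≤-antisym; <⇒≤; <⇒≢; ≤-pred; ≤∧≢⇒<; ≰⇒>; ≮⇒≥; n≤0⇒n≡0; m≤n⇒m≤1+n; n≤1+n;
         1+n≰n; 1+n≢n; module ≤-Reasoning; +-identityʳ; +-suc; ≤⇒≤′; m≤m⊔n; m≤n⊔m)
open import Data.Fin using (Fin; zero)
open import Data.Fin.Properties using (_≟_; any?)
open import Data.Fin.Subset using (Subset; ∣_∣; _⊂_) renaming (_∈_ to _∈ₛ_)
open import Data.Fin.Subset.Properties using (_⊂?_; p⊂q⇒∣p∣<∣q∣; ∣p∣≤n; x∈p⇒∣p-x∣<∣p∣)
open import Data.Vec using (tabulate)
open import Data.Vec.Properties using (lookup∘tabulate; lookup⇒[]=; []=⇒lookup)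
open import Data.Vec.Functional using (updateAt)
open import Data.Vec.Functional.Properties using (updateAt-updates; updateAt-minimal)
open import Data.Bool using (Bool; true; false; T)
open import Data.Bool.Properties using (T-≡; T-∨; T-∧)
open import Data.List using (_∷_; foldr; map; allFin)
open import Data.List.Relation.Unary.Any using (here; there; satisfied)
open import Data.List.Relation.Unary.Any.Properties using (any⁺; any⁻)
open import Data.List.Membership.Propositional using (_∈_; lose)
open import Data.List.Membership.Propositional.Properties using (∈-allFin)
open import Data.Product using (∃; ∃-syntax; _×_; _,_; proj₁; proj₂)
open import Data.Sum using (_⊎_; inj₁; inj₂)
open import Data.Empty using (⊥-elim)
open import Function using (_∘_)
open import Function.Bundles using (Equivalence)
open import Relation.Nullary using (¬_; yes; no; Dec; ¬?)
open import Relation.Nullary.Decidable using (_×-dec_; toWitness; fromWitness; T?)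
open import Relation.Binary.Construct.Closure.ReflexiveTransitive using (ε; _◅_; _◅◅_; reverse)
open import Relation.Binary.PropositionalEquality using (_≡_; _≢_; refl; trans; subst; ≢-sym)
import Relation.Binary.PropositionalEquality as ≡

open Equivalence using (to; from)

least-satisfies : ∀ (p : ℕ → Bool) i fuel → T (p (i + fuel)) → T (p (least p i fuel))
least-satisfies p i zero h rewrite +-identityʳ i = h
least-satisfies p i (suc fuel) h with p i in eq
... | true  = subst T (≡.sym eq) _
... | false = least-satisfies p (suc i) fuel (subst (T ∘ p) (+-suc i fuel) h)

least-minimal : ∀ (p : ℕ → Bool) i fuel {j} → T (p j) → i ≤ j → least p i fuel ≤ j
least-minimal p i zero       h i≤j = i≤j
least-minimal p i (suc fuel) h i≤j with p i in eq
... | true  = i≤j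
... | false = least-minimal p (suc i) fuel h (≤∧≢⇒< i≤j λ { refl → subst T eq h })

≤-foldr-⊔ : ∀ {A : Set} (f : A → ℕ) {x xs} → x ∈ xs → f x ≤ foldr _⊔_ 0 (map f xs)
≤-foldr-⊔ f {xs = y ∷ _} (here refl) = m≤m⊔n (f y) _
≤-foldr-⊔ f {xs = y ∷ _} (there x∈)  = ≤-trans (≤-foldr-⊔ f x∈) (m≤n⊔m (f y) _)

Fin1-unique : (a b : Fin 1) → a ≡ b
Fin1-unique zero zero = refl

avoid : ∀ {n} {P : Fin n → Set} {u₁ u₂} → u₁ ≢ u₂ → P u₁ → P u₂ → ∀ s → ∃ λ w → w ≢ s × P w
avoid {u₁ = u₁} {u₂} u₁≢u₂ p₁ p₂ s with u₁ ≟ s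
... | yes refl = u₂ , ≢-sym u₁≢u₂ , p₂
... | no u₁≢s  = u₁ , u₁≢s , p₁

module Distance {n : ℕ} (G : Graph n) where

  -- A record rather than T (within G k u v), so that k, u and v can be inferred.
  record Within (k : ℕ) (u v : Fin n) : Set where
    constructor walk
    field holds : T (within G k u v)
  open Within

  adj-sym : ∀ {u v} → adj G u v ≡ true → adj G v u ≡ true
  adj-sym {u} {v} a = trans (Graph.sym G v u) a

  within-zero : ∀ {u v} → Within 0 u v → u ≡ v
  within-zero h = toWitness (holds h)

  within-refl : ∀ {v} → Within 0 v v
  within-refl = walk (fromWitness refl)

  within-suc⁻ : ∀ {k u v} → Within (suc k) u v →
                Within k u v ⊎ ∃ λ w → adj G u w ≡ true × Within k w v
  within-suc⁻ (walk h) with to T-∨ h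
  ... | inj₁ h′ = inj₁ (walk h′)
  ... | inj₂ h′ with satisfied (any⁻ _ (allFin n) h′)
  ...   | w , h″ with to T-∧ h″
  ...     | a , h‴ = inj₂ (w , to T-≡ a , walk h‴)

  within-suc : ∀ {k u v} → Within k u v → Within (suc k) u v
  within-suc (walk h) = walk (from T-∨ (inj₁ h))

  within-step : ∀ {k u w v} → adj G u w ≡ true → Within k w v → Within (suc k) u v
  within-step {w = w} a (walk h) =
    walk (from T-∨ (inj₂ (any⁺ _ (lose (∈-allFin w) (from T-∧ (from T-≡ a , h))))))

  within-snoc : ∀ {k u w v} → Within k u w → adj G w v ≡ true → Within (suc k) u v
  within-snoc {zero} h a with within-zero h
  ... | refl = within-step a within-refl
  within-snoc {suc k} h a with within-suc⁻ h
  ... | inj₁ h′ = within-suc (within-snoc h′ a)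
  ... | inj₂ (w , a′ , h′) = within-step a′ (within-snoc h′ a)

  within-sym : ∀ {k u v} → Within k u v → Within k v u
  within-sym {zero} h with within-zero h
  ... | refl = h
  within-sym {suc k} h with within-suc⁻ h
  ... | inj₁ h′ = within-suc (within-sym h′)
  ... | inj₂ (w , a , h′) = within-snoc (within-sym h′) (adj-sym a)

  within-weaken : ∀ {k m u v} → k ≤ m → Within k u v → Within m u v
  within-weaken {k} {m} {u} {v} k≤m h = go (≤⇒≤′ k≤m)
    where
    go : ∀ {m} → k ≤′ m → Within m u v
    go ≤′-refl       = h
    go (≤′-step k≤m) = within-suc (go k≤m)

  ball : ℕ → Fin n → Subset n
  ball k u = tabulate (λ x → within G k x u)

  ∈-ball⁺ : ∀ {k x u} → Within k x u → x ∈ₛ ball k u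
  ∈-ball⁺ {k} {x} {u} h = lookup⇒[]= x _ (trans (lookup∘tabulate _ x) (to T-≡ (holds h)))

  ∈-ball⁻ : ∀ k u {x} → x ∈ₛ ball k u → Within k x u
  ∈-ball⁻ k u {x} x∈ = walk (from T-≡ (trans (≡.sym (lookup∘tabulate _ x)) ([]=⇒lookup x∈)))

  Stable : Fin n → ℕ → Set
  Stable u j = ∀ x → Within (suc j) x u → Within j x u

  stable-shrink : ∀ {u j} → Stable u j → ∀ m {x} → Within m x u → Within j x u
  stable-shrink st zero    h = within-weaken z≤n h
  stable-shrink {u} {j} st (suc m) {x} h with within-suc⁻ h
  ... | inj₁ h′ = stable-shrink {u} {j} st m h′
  ... | inj₂ (w , a , h′) = st x (within-step a (stable-shrink {u} {j} st m h′))

  ball-grows-or-stable : ∀ k u → ball k u ⊂ ball (suc k) u ⊎ Stable u k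
  ball-grows-or-stable k u with ball k u ⊂? ball (suc k) u
  ... | yes grows = inj₁ grows
  ... | no ¬grows = inj₂ stable
    where
    stable : Stable u k
    stable x h with T? (within G k x u)
    ... | yes h′ = walk h′
    ... | no ¬h′ = ⊥-elim (¬grows ((λ y∈ → ∈-ball⁺ (within-suc (∈-ball⁻ k u y∈))) , x , ∈-ball⁺ h , ¬h′ ∘ holds ∘ ∈-ball⁻ k u))

  stable-or-large : ∀ k u → (∃ λ j → j ≤ k × Stable u j) ⊎ k < ∣ ball k u ∣
  stable-or-large zero u = inj₂ (≤-trans (s≤s z≤n) (x∈p⇒∣p-x∣<∣p∣ (∈-ball⁺ {0} {u} within-refl)))
  stable-or-large (suc k) u with stable-or-large k u
  ... | inj₁ (j , j≤k , st) = inj₁ (j , m≤n⇒m≤1+n j≤k , st)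
  ... | inj₂ large with ball-grows-or-stable k u
  ...   | inj₁ grows = inj₂ (≤-trans (s≤s large) (p⊂q⇒∣p∣<∣q∣ grows))
  ...   | inj₂ st    = inj₁ (k , n≤1+n k , st)

  -- The balls around u grow strictly until they stop growing for good, and they have at
  -- most n elements, so any walk can be shortened to one of length at most n; this is
  -- what makes the search in dist, which only tries lengths up to n, find the distance.
  connected⇒within-n : Connected G → ∀ x u → Within n x u
  connected⇒within-n connected x u with stable-or-large n u | connected x u
  ... | inj₂ large         | _     = ⊥-elim (1+n≰n (≤-trans large (∣p∣≤n (ball n u))))
  ... | inj₁ (j , j≤n , st) | m , h = within-weaken j≤n (stable-shrink st m (walk (from T-≡ h)))

  dist-minimal : ∀ {k u v} → Within k u v → dist G u v ≤ k
  dist-minimal (walk h) = least-minimal _ 0 n h z≤n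

  dist-refl : ∀ v → dist G v v ≡ 0
  dist-refl v = n≤0⇒n≡0 (dist-minimal within-refl)

  dist≤ecc : ∀ v w → dist G v w ≤ ecc G v
  dist≤ecc v w = ≤-foldr-⊔ (dist G v) (∈-allFin w)

  module OfConnected (connected : Connected G) where

    dist-walk : ∀ u v → Within (dist G u v) u v
    dist-walk u v = walk (least-satisfies (λ k → within G k u v) 0 n (holds (connected⇒within-n connected u v)))

    dist≡0⇒≡ : ∀ {u v} → dist G u v ≡ 0 → u ≡ v
    dist≡0⇒≡ {u} {v} d≡0 = within-zero (subst (λ k → Within k u v) d≡0 (dist-walk u v))

    dist-sym : ∀ u v → dist G u v ≡ dist G v u
    dist-sym u v = ≤-antisym (dist-minimal (within-sym (dist-walk v u)))
                             (dist-minimal (within-sym (dist-walk u v)))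

    dist-adj : ∀ {x z u} → adj G x z ≡ true → dist G x u ≤ suc (dist G z u)
    dist-adj {z = z} {u} a = dist-minimal (within-step a (dist-walk z u))

    dist-suc⇒closer-neighbour : ∀ {z u k} → dist G z u ≡ suc k →
                                 ∃ λ y → adj G z y ≡ true × dist G y u ≡ k
    dist-suc⇒closer-neighbour {z} {u} {k} d≡1+k
      with within-suc⁻ (subst (λ m → Within m z u) d≡1+k (dist-walk z u))
    ... | inj₁ h = ⊥-elim (1+n≰n (subst (_≤ k) d≡1+k (dist-minimal h)))
    ... | inj₂ (y , a , h) =
      y , a , ≤-antisym (dist-minimal h) (≤-pred (subst (_≤ suc (dist G y u)) d≡1+k (dist-adj a)))

module Broadcasts {n : ℕ} (G : Graph n) where
  open Distance G

  Reaches : (Fin n → ℕ) → Fin n → Fin n → Set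
  Reaches f v x = Broadcasting G f v × InN G f v x

  Shared : (Fin n → ℕ) → Fin n → Set
  Shared f s = ∃ λ y → ∃ λ u → u ≢ s × InN G f s y × Reaches f u y

  shared? : ∀ f s → Dec (Shared f s)
  shared? f s = any? λ y → any? λ u →
    ¬? (u ≟ s) ×-dec (dist G y s ≤? f s) ×-dec (0 <? f u) ×-dec (dist G y u ≤? f u)

  TwoBroadcasters : (Fin n → ℕ) → Set
  TwoBroadcasters f = ∃[ u ] ∃[ v ] (u ≢ v × Broadcasting G f u × Broadcasting G f v)

  ∈N-self : ∀ f v → InN G f v v
  ∈N-self f v = subst (_≤ f v) (≡.sym (dist-refl v)) z≤n

  reaches-self : ∀ f {v} → Broadcasting G f v → Reaches f v v
  reaches-self f {v} bv = bv , ∈N-self f v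

  covAdj-sym : ∀ {f x y} → CovAdj G f x y → CovAdj G f y x
  covAdj-sym (a , u , bu , x∈ , y∈ , inj₁ x∉B) = adj-sym a , u , bu , y∈ , x∈ , inj₂ x∉B
  covAdj-sym (a , u , bu , x∈ , y∈ , inj₂ y∉B) = adj-sym a , u , bu , y∈ , x∈ , inj₁ y∉B

  leaving-N⇒shared : ∀ {f v a w} → SameComponent G f a w → InN G f v a →
                     w ≢ v → Broadcasting G f w → Shared f v
  leaving-N⇒shared {f} {w = w} ε a∈N w≢v bw = w , w , w≢v , a∈N , reaches-self f bw
  leaving-N⇒shared {f} {v} {a} ((_ , u , bu , a∈Nu , b∈Nu , _) ◅ path) a∈N w≢v bw
    with dist G _ v ≤? f v
  ... | yes b∈N = leaving-N⇒shared path b∈N w≢v bw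
  ... | no  b∉N = a , u , (λ { refl → b∉N b∈Nu }) , a∈N , bu , a∈Nu

  twoPerComponent⇒shared : ∀ {f} → EveryComponentTwoBroadcasters G f → ∀ v → Shared f v
  twoPerComponent⇒shared {f} two v with two v
  ... | u₁ , u₂ , u₁≢u₂ , b₁ , b₂ , p₁ , p₂
    with avoid {P = λ w → Broadcasting G f w × SameComponent G f v w} u₁≢u₂ (b₁ , p₁) (b₂ , p₂) v
  ...   | w , w≢v , bw , path = leaving-N⇒shared path (∈N-self f v) w≢v bw

  shared-caps : ∀ {f g v} → BnIndependent G g → (∀ w → f w ≤ g w) → Shared f v → g v ≤ f v
  shared-caps {f} {g} {v} bn-g f≤g (y , u , u≢v , y∈Nv , bu , y∈Nu) with 0 <? g v
  ... | no ¬bv = ≤-trans (≮⇒≥ ¬bv) z≤n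
  ... | yes bv = ≤-trans (bn-g y (v , u , ≢-sym u≢v , bv , ≤-trans bu (f≤g u) ,
                                  ≤-trans y∈Nv (f≤g v) , ≤-trans y∈Nu (f≤g u)) v bv)
                         y∈Nv

  shared⇒maximal : ∀ {f} → BnIndependent G f → (∀ v → Shared f v) → MaximalBnIndependent G f
  shared⇒maximal bn shared =
    bn , λ g _ bn-g f≤g v → ≤-antisym (shared-caps bn-g f≤g (shared v)) (f≤g v)

  module _ (connected : Connected G) where
    open OfConnected connected

    reaches⇒sameComponent : ∀ {f u x} → Reaches f u x → SameComponent G f x u
    reaches⇒sameComponent {f} {u} (bu , x∈N) = descend _ _ refl x∈N
      where
      descend : ∀ k x → dist G x u ≡ k → InN G f u x → SameComponent G f x u
      descend zero x dx≡0 _ with dist≡0⇒≡ dx≡0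
      ... | refl = ε
      descend (suc k) x dx≡1+k x∈N with dist-suc⇒closer-neighbour dx≡1+k
      ... | y , a , dy≡k = (a , u , bu , x∈N , y∈N , inj₂ y∉B) ◅ descend k y dy≡k y∈N
        where
        k<f : k < f u
        k<f = subst (_≤ f u) dx≡1+k x∈N
        y∈N : InN G f u y
        y∈N = ≤-trans (≤-reflexive dy≡k) (<⇒≤ k<f)
        y∉B : ¬ InB G f u y
        y∉B dy≡f = <⇒≢ k<f (trans (≡.sym dy≡k) dy≡f)

    reached-by-some : ∀ {f} → (∀ s → Shared f s) → ∀ x → ∃ λ u → Reaches f u x
    reached-by-some {f} shared x with 0 <? f x
    ... | yes bx = x , reaches-self f bx
    ... | no ¬bx with shared x
    ...   | y , u , _ , y∈N , ry with dist≡0⇒≡ (n≤0⇒n≡0 (≤-trans y∈N (≮⇒≥ ¬bx)))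
    ...     | refl = u , ry

    shared⇒twoPerComponent : ∀ {f} → (∀ s → Shared f s) → EveryComponentTwoBroadcasters G f
    shared⇒twoPerComponent {f} shared x with reached-by-some shared x
    ... | u , ru with shared u
    ...   | y , u′ , u′≢u , y∈Nu , ru′ =
      u , u′ , ≢-sym u′≢u , proj₁ ru , proj₁ ru′ , x~u ,
      x~u ◅◅ reverse covAdj-sym (reaches⇒sameComponent (proj₁ ru , y∈Nu)) ◅◅ reaches⇒sameComponent ru′
      where
      x~u : SameComponent G f x u
      x~u = reaches⇒sameComponent ru

    module Raise {f : Fin n → ℕ} {s : Fin n} (¬shared : ¬ Shared f s) where

      raised : Fin n → ℕ
      raised = updateAt f s suc

      raised-at : raised s ≡ suc (f s)
      raised-at = updateAt-updates s f

      raised-off : ∀ {v} → v ≢ s → raised v ≡ f v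
      raised-off {v} = updateAt-minimal v s f

      ≤-raised : ∀ v → f v ≤ raised v
      ≤-raised v with v ≟ s
      ... | yes refl = ≤-trans (n≤1+n (f s)) (≤-reflexive (≡.sym raised-at))
      ... | no  v≢s  = ≤-reflexive (≡.sym (raised-off v≢s))

      unraise : ∀ {v z} → v ≢ s → Reaches raised v z → Reaches f v z
      unraise {v} {z} v≢s = subst (λ m → 0 < m × dist G z v ≤ m) (raised-off v≢s)

      outside-N : ∀ {v z} → v ≢ s → Reaches f v z → f s < dist G z s
      outside-N {v} {z} v≢s rv = ≰⇒> λ z∈N → ¬shared (z , v , v≢s , z∈N , rv)

      raised-isBroadcast : IsBroadcast G f → TwoBroadcasters f → IsBroadcast G raised
      raised-isBroadcast (bounded , _) (u₁ , u₂ , u₁≢u₂ , b₁ , b₂) =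
        bounded′ , λ { refl → ⊥-elim (u₁≢u₂ (Fin1-unique u₁ u₂)) }
        where
        bounded′ : 2 ≤ n → ∀ v → raised v ≤ ecc G v
        bounded′ 2≤n v with v ≟ s
        ... | no v≢s = subst (_≤ ecc G v) (≡.sym (raised-off v≢s)) (bounded 2≤n v)
        ... | yes refl with avoid u₁≢u₂ b₁ b₂ s
        ...   | w , w≢s , bw = begin
          raised s   ≡⟨ raised-at ⟩
          suc (f s)  ≤⟨ outside-N w≢s (reaches-self f bw) ⟩
          dist G w s ≡⟨ dist-sym w s ⟩
          dist G s w ≤⟨ dist≤ecc s w ⟩
          ecc G s    ∎
          where open ≤-Reasoning

      raised-bound : ∀ {v z u} → v ≢ s → Reaches f v z →
                     (u ≢ s → Broadcasting G f u → f u ≤ dist G z u) →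
                     Broadcasting G raised u → raised u ≤ dist G z u
      raised-bound {z = z} {u} v≢s rv bound bu with u ≟ s
      ... | yes refl = subst (_≤ dist G z s) (≡.sym raised-at) (outside-N v≢s rv)
      ... | no  u≢s  = subst (_≤ dist G z u) (≡.sym (raised-off u≢s))
                             (bound u≢s (subst (0 <_) (raised-off u≢s) bu))

      frontier-bound : ∀ {v z u} → v ≢ s → Reaches f v z → InN G raised s z →
                       u ≢ s → Broadcasting G f u → f u ≤ dist G z u
      frontier-bound {z = z} {u} v≢s rv z∈N u≢s bu with f u ≤? dist G z u
      ... | yes ok = ok
      ... | no ¬ok with dist-suc⇒closer-neighbour dz≡1+fs
        where
        dz≡1+fs : dist G z s ≡ suc (f s)
        dz≡1+fs = ≤-antisym (subst (dist G z s ≤_) raised-at z∈N) (outside-N v≢s rv)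
      ...   | y , a , dy≡fs = ⊥-elim (¬shared (y , u , u≢s , ≤-reflexive dy≡fs , bu ,
                                               ≤-trans (dist-adj (adj-sym a)) (≰⇒> ¬ok)))

      raised-bnIndependent : BnIndependent G f → BnIndependent G raised
      raised-bnIndependent bn z (v₁ , v₂ , v₁≢v₂ , b₁ , b₂ , z∈N₁ , z∈N₂) u bu
        with v₁ ≟ s | v₂ ≟ s
      ... | yes refl | yes refl = ⊥-elim (v₁≢v₂ refl)
      ... | yes refl | no v₂≢s =
        raised-bound v₂≢s r₂ (frontier-bound v₂≢s r₂ z∈N₁) bu
        where
        r₂ : Reaches f v₂ z
        r₂ = unraise v₂≢s (b₂ , z∈N₂)
      ... | no v₁≢s | yes refl =
        raised-bound v₁≢s r₁ (frontier-bound v₁≢s r₁ z∈N₂) bu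
        where
        r₁ : Reaches f v₁ z
        r₁ = unraise v₁≢s (b₁ , z∈N₁)
      ... | no v₁≢s | no v₂≢s
        with unraise v₁≢s (b₁ , z∈N₁) | unraise v₂≢s (b₂ , z∈N₂)
      ...   | r₁@(b₁′ , z∈N₁′) | b₂′ , z∈N₂′ =
        raised-bound v₁≢s r₁ (λ _ bu′ → bn z (v₁ , v₂ , v₁≢v₂ , b₁′ , b₂′ , z∈N₁′ , z∈N₂′) u bu′) bu

    maximal⇒shared : ∀ {f} → IsBroadcast G f → TwoBroadcasters f →
                     MaximalBnIndependent G f → ∀ s → Shared f s
    maximal⇒shared {f} isB two (bn , maximal) s with shared? f s
    ... | yes sh = sh
    ... | no ¬sh = ⊥-elim (1+n≢n (trans (≡.sym raised-at)
                     (maximal raised (raised-isBroadcast isB two) (raised-bnIndependent bn) ≤-raised s)))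
      where open Raise ¬sh

open Broadcasts

proposition3p1 : {n : ℕ} (G : Graph n) → Connected G →
    (f : Fin n → ℕ) → IsBroadcast G f → BnIndependent G f →
    (∃[ u ] ∃[ v ] (u ≢ v × Broadcasting G f u × Broadcasting G f v)) →
    (MaximalBnIndependent G f → EveryComponentTwoBroadcasters G f) ×
    (EveryComponentTwoBroadcasters G f → MaximalBnIndependent G f)
proposition3p1 G connected f isB bn two =
  shared⇒twoPerComponent G connected ∘ maximal⇒shared G connected isB two ,
  shared⇒maximal G bn ∘ twoPerComponent⇒shared G
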